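{- Let $0<\alpha<1/2$ and $0<\rho<1$ be constants and assume that $2\le r(n)\le(1-\rho)n$ for $n\in\mathbb{N}$. Then there exists $n_1\in\mathbb{N}$ such that the class $\mathcal{F}_{(\alpha,r)}$ of $(\alpha,r)$-near-regular degree sequences of length at least $n_1$ is strongly stable.
   Context: A degree sequence $\boldsymbol{d}=(d_1,\dots,d_n)$ (of length $n$, with $r=r(n)$) is $(\alpha,r)$-near-regular if $\max_i|d_i-r|\le r^\alpha$. For a degree sequence $\boldsymbol{d}$, $\mathcal{G}(\boldsymbol{d})$ is the set of simple labelled graphs on $[n]$ with degree sequence $\boldsymbol{d}$, and $\mathcal{G}'(\boldsymbol{d})=\bigcup_{\boldsymbol{d}'}\mathcal{G}(\boldsymbol{d}')$ over all $\boldsymbol{d}'$ with $\sum_i d'_i=\sum_i d_i$ and $\sum_i|d'_i-d_i|=2$. An alternating $(u,v)$-path in a graph $G$ is an edge-disjoint $(u,v)$-path in the complete graph on $[n]$ that alternates between edges and non-edges of $G$, starting with an edge of $G$ incident to $u$ and ending with a non-edge of $G$ incident to $v$. A class $\mathcal{D}$ of degree sequences is strongly stable if there is a constant $k\in\mathbb{N}$ such that for all $\boldsymbol{d}\in\mathcal{D}$ and all $G\in\mathcal{G}'(\boldsymbol{d})$ there is an alternating $(u,v)$-path in $G$ of length at most $k$, where $u,v$ are the unique nodes with $\deg_G(u)=d_u+1$ and $\deg_G(v)=d_v-1$.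
   Formalization: The constants α and ρ are taken to be rational. -}

module Defs where

open import Data.Nat using (ℕ; zero; suc; _+_; _*_; _∸_; _^_; _≤_; _<_; _≥_; ∣_-_∣)
open import Data.Bool using (Bool; true; false; if_then_else_)
open import Data.Fin using (Fin; toℕ; inject₁; fromℕ) renaming (zero to fzero; suc to fsuc)
open import Data.List using (List; map; allFin)
open import Data.Nat.ListAction using (sum)
open import Data.Product using (Σ; ∃; _×_; _,_)
open import Data.Sum using (_⊎_)
open import Relation.Binary.PropositionalEquality using (_≡_; _≢_)
open import Relation.Nullary using (¬_)

DegSeq : ℕ → Set
DegSeq n = Fin n → ℕ

sumFin : ∀ {n} → (Fin n → ℕ) → ℕ
sumFin {n} f = sum (map f (allFin n))

record Graph (n : ℕ) : Set where
  field
    adj   : Fin n → Fin n → Bool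
    sym   : ∀ i j → adj i j ≡ adj j i
    loopless : ∀ i → adj i i ≡ false
open Graph public

deg : ∀ {n} → Graph n → Fin n → ℕ
deg G i = sumFin (λ j → if adj G i j then 1 else 0)

-- (α,r)-near-regular with α = a / b (a rational exponent):
-- |d_i - r| ≤ r^(a/b)  ⟺  |d_i - r|^b ≤ r^a   (b > 0, all quantities ≥ 0).
NearRegular : (a b r : ℕ) → ∀ {n} → DegSeq n → Set
NearRegular a b r d = ∀ i → ∣ d i - r ∣ ^ b ≤ r ^ a

InG' : ∀ {n} → DegSeq n → Graph n → Set
InG' d G = (sumFin (deg G) ≡ sumFin d) × (sumFin (λ i → ∣ deg G i - d i ∣) ≡ 2)

isEven : ℕ → Bool
isEven zero = true
isEven (suc zero) = false
isEven (suc (suc m)) = isEven m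

SameEdge : ∀ {n} → Fin n → Fin n → Fin n → Fin n → Set
SameEdge a b c d = ((a ≡ c) × (b ≡ d)) ⊎ ((a ≡ d) × (b ≡ c))

-- An alternating (u,v)-path of length ℓ in G: a vertex sequence w_0 = u, …, w_ℓ = v,
-- whose ℓ edges w_j w_{j+1} are edges of K_n (w_j ≠ w_{j+1}), pairwise distinct
-- (edge-disjoint), and alternate edge / non-edge of G, starting with an edge of G
-- (j = 0) and ending with a non-edge of G (so ℓ is even and ℓ ≥ 1).
record AlternatingPath {n} (G : Graph n) (u v : Fin n) (ℓ : ℕ) : Set where
  field
    w        : Fin (suc ℓ) → Fin n
    nonempty : 1 ≤ ℓ
    endsOdd  : isEven ℓ ≡ true
    start    : w fzero ≡ u
    end      : w (fromℕ ℓ) ≡ v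
    proper   : ∀ (j : Fin ℓ) → w (inject₁ j) ≢ w (fsuc j)
    distinct : ∀ (j j' : Fin ℓ) → j ≢ j' →
               ¬ SameEdge (w (inject₁ j)) (w (fsuc j)) (w (inject₁ j')) (w (fsuc j'))
    alternating : ∀ (j : Fin ℓ) → adj G (w (inject₁ j)) (w (fsuc j)) ≡ isEven (toℕ j)

DegClass : Set₁
DegClass = (n : ℕ) → DegSeq n → Set

StronglyStable : DegClass → Set
StronglyStable 𝒟 =
  ∃ λ (k : ℕ) → ∀ n (d : DegSeq n) → 𝒟 n d →
    ∀ (G : Graph n) → InG' d G →
    ∀ (u v : Fin n) → deg G u ≡ d u + 1 → deg G v + 1 ≡ d v →
    ∃ λ (ℓ : ℕ) → (ℓ ≤ k) × AlternatingPath G u v ℓ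

NearRegClass : (a b : ℕ) (r : ℕ → ℕ) (n₁ : ℕ) → DegClass
NearRegClass a b r n₁ n d = (n₁ ≤ n) × NearRegular a b (r n) d

-- Let u carry the surplus and v the deficit, let W be the non-neighbours of v other than v,
-- and C the vertices equal or adjacent to every neighbour of u. Without an alternating
-- (u,v)-path of length 2 no neighbour of u lies in W, and without one of length 4 every
-- neighbour of a vertex of W lies in C. Counting the edges between W and C gives
--   min d · |W| ≤ |C| · max_{y ∈ C} |N(y) ∩ W| ≤ (max d + 2)(max d − d_u + 1),
-- because |C| ≤ deg x + 1 for any neighbour x of u, and for y ∈ C the set N(y) ∩ W is
-- disjoint from N(u) ⊆ N(y) ∪ {y}.
-- As |W| = n − d_v, the left side is about r(n − r) ≥ r²/q when r ≤ q n/(q + 1). Once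
-- r ≥ (256 q)^b, all degrees lie within t = r/(128 q) of r and the right side is O(t r),
-- which is too small; for smaller r the inequality bounds n instead.

module Submission where

open import Defs renaming (sym to adj-sym)

open import Data.Nat.Properties hiding (_≟_)
open import Algebra.Properties.Semiring.Sum +-*-semiring
  using (sum; sum-syntax; ∑-distrib-+; ∑-comm; *-distribˡ-sum; sum-replicate-zero; sum-cong-≗)
open import Data.Bool using (Bool; true; false; if_then_else_)
import Data.Bool as Bool
open import Data.Empty using (⊥; ⊥-elim)
open import Data.Fin using (Fin) renaming (zero to fzero; suc to fsuc)
open import Data.Fin.Patterns using (0F; 1F; 2F; 3F; 4F)
open import Data.Fin.Properties using (_≟_; all?; any?)
import Data.List as List using (tabulate)
open import Data.List.Properties using (map-tabulate)
open import Data.Nat using (ℕ; zero; suc; _+_; _*_; _∸_; _^_; _≤_; _<_; z≤n; s≤s; _≤?_; _<?_; NonZero; ∣_-_∣; >-nonZero)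
open import Data.Nat.DivMod using (_/_; m/n*n≤m; m/n≤m; m*n/n≡m; /-monoˡ-≤)
import Data.Nat.ListAction as List using (sum)
open import Data.Nat.Tactic.RingSolver using (solve-∀)
open import Data.Product using (∃; _×_; _,_; proj₁; proj₂; map₂)
open import Data.Sum using (_⊎_; inj₁; inj₂)
open import Function using (id; _∘_)
open import Relation.Binary.PropositionalEquality
open import Relation.Nullary using (¬_; Dec; yes; no; does)
open import Relation.Nullary.Decidable using (¬?; _×-dec_; _⊎-dec_; _→-dec_; from-yes)

χ : Bool → ℕ
χ b = if b then 1 else 0

𝟙 : ∀ {A : Set} → Dec A → ℕ
𝟙 a? = χ (does a?)

true≢false : true ≢ false
true≢false ()

sumFin≡sum : ∀ {n} (f : Fin n → ℕ) → sumFin f ≡ sum f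
sumFin≡sum f = trans (cong List.sum (map-tabulate id f)) (sum-tabulate f)
  where
  sum-tabulate : ∀ {n} (f : Fin n → ℕ) → List.sum (List.tabulate f) ≡ sum f
  sum-tabulate {zero}  f = refl
  sum-tabulate {suc n} f = cong (f fzero +_) (sum-tabulate (λ i → f (fsuc i)))

sum-mono-≤ : ∀ {n} {f g : Fin n → ℕ} → (∀ i → f i ≤ g i) → sum f ≤ sum g
sum-mono-≤ {zero}  f≤g = z≤n
sum-mono-≤ {suc n} f≤g = +-mono-≤ (f≤g fzero) (sum-mono-≤ (λ i → f≤g (fsuc i)))

sum-const-1 : ∀ n → ∑[ i < n ] 1 ≡ n
sum-const-1 zero    = refl
sum-const-1 (suc n) = cong suc (sum-const-1 n)

pointMass : ∀ {n} → Fin n → ℕ → Fin n → ℕ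
pointMass x c i = if does (i ≟ x) then c else 0

sum-pointMass : ∀ {n} (x : Fin n) c → sum (pointMass x c) ≡ c
sum-pointMass {suc n} fzero    c = trans (cong (c +_) (sum-replicate-zero n)) (+-identityʳ c)
sum-pointMass {suc n} (fsuc x) c = sum-pointMass x c

pointMass-diag : ∀ {n} (x : Fin n) c → pointMass x c x ≡ c
pointMass-diag x c with x ≟ x
... | yes _   = refl
... | no x≢x  = ⊥-elim (x≢x refl)

sum-distinct₃-≤ : ∀ {n} (f : Fin n → ℕ) {u v w : Fin n} → u ≢ v → u ≢ w → v ≢ w →
                  f u + f v + f w ≤ sum f
sum-distinct₃-≤ f {u} {v} {w} u≢v u≢w v≢w = begin
  f u + f v + f w
    ≡⟨ sym (cong₂ _+_ (cong₂ _+_ (sum-pointMass u (f u)) (sum-pointMass v (f v))) (sum-pointMass w (f w))) ⟩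
  sum (pointMass u (f u)) + sum (pointMass v (f v)) + sum (pointMass w (f w))
    ≡⟨ cong (_+ sum (pointMass w (f w))) (sym (∑-distrib-+ (pointMass u (f u)) (pointMass v (f v)))) ⟩
  ∑[ i < _ ] (pointMass u (f u) i + pointMass v (f v) i) + sum (pointMass w (f w))
    ≡⟨ sym (∑-distrib-+ _ (pointMass w (f w))) ⟩
  ∑[ i < _ ] (pointMass u (f u) i + pointMass v (f v) i + pointMass w (f w) i)
    ≤⟨ sum-mono-≤ at ⟩
  sum f ∎
  where
  open ≤-Reasoning
  at : ∀ i → pointMass u (f u) i + pointMass v (f v) i + pointMass w (f w) i ≤ f i
  at i with i ≟ u | i ≟ v | i ≟ w
  ... | yes refl | yes refl | _        = ⊥-elim (u≢v refl)
  ... | yes refl | no _     | yes refl = ⊥-elim (u≢w refl)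
  ... | no _     | yes refl | yes refl = ⊥-elim (v≢w refl)
  ... | yes refl | no _     | no _     = ≤-reflexive (trans (+-identityʳ _) (+-identityʳ (f i)))
  ... | no _     | yes refl | no _     = ≤-reflexive (+-identityʳ (f i))
  ... | no _     | no _     | yes refl = ≤-refl
  ... | no _     | no _     | no _     = z≤n

module _ {n} (G : Graph n) where

  Alt₂ : Fin n → Fin n → Fin n → Set
  Alt₂ u v x = (adj G u x ≡ true) × (x ≢ v) × (adj G x v ≡ false)

  Alt₄ : Fin n → Fin n → Fin n → Fin n → Fin n → Set
  Alt₄ u v x y z = (adj G u x ≡ true) × (y ≢ x) × (adj G x y ≡ false) ×
                   (adj G y z ≡ true) × (z ≢ v) × (adj G z v ≡ false)

  private
    SameEdge-sym : ∀ {a b c d : Fin n} → SameEdge a b c d → SameEdge c d a b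
    SameEdge-sym (inj₁ (p , q)) = inj₁ (sym p , sym q)
    SameEdge-sym (inj₂ (p , q)) = inj₂ (sym q , sym p)

    adj-SameEdge : ∀ {a b c d} → SameEdge a b c d → adj G a b ≡ adj G c d
    adj-SameEdge (inj₁ (refl , refl)) = refl
    adj-SameEdge (inj₂ (refl , refl)) = adj-sym G _ _

    edge≢nonEdge : ∀ {a b c d} → adj G a b ≡ true → adj G c d ≡ false → ¬ SameEdge a b c d
    edge≢nonEdge ab cd s = true≢false (trans (sym ab) (trans (adj-SameEdge s) cd))

    nonEdge≢edge : ∀ {a b c d} → adj G a b ≡ false → adj G c d ≡ true → ¬ SameEdge a b c d
    nonEdge≢edge ab cd = edge≢nonEdge cd ab ∘ SameEdge-sym

    adj⇒≢ : ∀ {a b} → adj G a b ≡ true → a ≢ b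
    adj⇒≢ {a} ab refl = true≢false (trans (sym ab) (loopless G a))

  alt₂⇒path : ∀ {u v x} → Alt₂ u v x → AlternatingPath G u v 2
  alt₂⇒path {u} {v} {x} (ux , x≢v , xv) = record
    { w           = λ { 0F → u ; 1F → x ; 2F → v }
    ; nonempty    = s≤s z≤n
    ; endsOdd     = refl
    ; start       = refl
    ; end         = refl
    ; proper      = λ { 0F → adj⇒≢ ux ; 1F → x≢v }
    ; distinct    = λ { 0F 0F j≢j' → ⊥-elim (j≢j' refl)
                      ; 0F 1F _    → edge≢nonEdge ux xv
                      ; 1F 0F _    → nonEdge≢edge xv ux
                      ; 1F 1F j≢j' → ⊥-elim (j≢j' refl) }
    ; alternating = λ { 0F → ux ; 1F → xv }
    }

  alt₄⇒path : ∀ {u v x y z} → Alt₄ u v x y z → AlternatingPath G u v 4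
  alt₄⇒path {u} {v} {x} {y} {z} (ux , y≢x , xy , yz , z≢v , zv) = record
    { w           = λ { 0F → u ; 1F → x ; 2F → y ; 3F → z ; 4F → v }
    ; nonempty    = s≤s z≤n
    ; endsOdd     = refl
    ; start       = refl
    ; end         = refl
    ; proper      = λ { 0F → adj⇒≢ ux ; 1F → y≢x ∘ sym ; 2F → adj⇒≢ yz ; 3F → z≢v }
    ; distinct    = λ { 0F 0F j≢j' → ⊥-elim (j≢j' refl)
                      ; 0F 1F _    → edge≢nonEdge ux xy
                      ; 0F 2F _    → ux≢yz
                      ; 0F 3F _    → edge≢nonEdge ux zv
                      ; 1F 0F _    → nonEdge≢edge xy ux
                      ; 1F 1F j≢j' → ⊥-elim (j≢j' refl)
                      ; 1F 2F _    → nonEdge≢edge xy yz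
                      ; 1F 3F _    → xy≢zv
                      ; 2F 0F _    → ux≢yz ∘ SameEdge-sym
                      ; 2F 1F _    → edge≢nonEdge yz xy
                      ; 2F 2F j≢j' → ⊥-elim (j≢j' refl)
                      ; 2F 3F _    → edge≢nonEdge yz zv
                      ; 3F 0F _    → nonEdge≢edge zv ux
                      ; 3F 1F _    → xy≢zv ∘ SameEdge-sym
                      ; 3F 2F _    → nonEdge≢edge zv yz
                      ; 3F 3F j≢j' → ⊥-elim (j≢j' refl) }
    ; alternating = λ { 0F → ux ; 1F → xy ; 2F → yz ; 3F → zv }
    }
    where
    ux≢yz : ¬ SameEdge u x y z
    ux≢yz (inj₁ (refl , refl)) = true≢false (trans (sym ux) (trans (adj-sym G u x) xy))
    ux≢yz (inj₂ (_ , refl))    = y≢x refl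
    xy≢zv : ¬ SameEdge x y z v
    xy≢zv (inj₁ (refl , refl)) = true≢false (trans (sym yz) (trans (adj-sym G y x) xy))
    xy≢zv (inj₂ (_ , refl))    = true≢false (trans (sym yz) (loopless G y))

  alt₂? : ∀ u v x → Dec (Alt₂ u v x)
  alt₂? u v x = (adj G u x Bool.≟ true) ×-dec ¬? (x ≟ v) ×-dec (adj G x v Bool.≟ false)

  alt₄? : ∀ u v x y z → Dec (Alt₄ u v x y z)
  alt₄? u v x y z = (adj G u x Bool.≟ true) ×-dec ¬? (y ≟ x) ×-dec (adj G x y Bool.≟ false) ×-dec
                    (adj G y z Bool.≟ true) ×-dec ¬? (z ≟ v) ×-dec (adj G z v Bool.≟ false)

  short-alternating-path : ∀ u v → ((∀ x → ¬ Alt₂ u v x) → (∀ x y z → ¬ Alt₄ u v x y z) → ⊥) →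
                           ∃ λ ℓ → ℓ ≤ 4 × AlternatingPath G u v ℓ
  short-alternating-path u v impossible with any? (alt₂? u v)
  ... | yes (x , alt) = 2 , s≤s (s≤s z≤n) , alt₂⇒path alt
  ... | no no-alt₂ with any? (λ x → any? (λ y → any? (λ z → alt₄? u v x y z)))
  ...   | yes (x , y , z , alt) = 4 , ≤-refl , alt₄⇒path alt
  ...   | no no-alt₄ = ⊥-elim (impossible (λ x alt → no-alt₂ (x , alt))
                                           (λ x y z alt → no-alt₄ (x , y , z , alt)))

DegreeCountingBound : ∀ {n} → DegSeq n → Fin n → Fin n → Set
DegreeCountingBound {n} d u v =
  ∀ m M S → (∀ z → z ≢ v → m ≤ d z) → (∀ i → d i ≤ M) → (∀ y → d y + 1 ≤ d u + S) →
  m * n ≤ S * (M + 2) + m * M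

module _ {n} (G : Graph n) (d : DegSeq n) {u v : Fin n}
  (deg-u : deg G u ≡ d u + 1) (deg-v : deg G v + 1 ≡ d v) where

  excess≢deficit : u ≢ v
  excess≢deficit refl = m+1+n≰m (d u) {1} (≤-reflexive (begin
    d u + 2       ≡⟨ +-assoc (d u) 1 1 ⟨
    d u + 1 + 1   ≡⟨ cong (_+ 1) deg-u ⟨
    deg G u + 1   ≡⟨ deg-v ⟩
    d u           ∎))
    where open ≡-Reasoning

  deg≡d-elsewhere : sumFin (λ i → ∣ deg G i - d i ∣) ≡ 2 →
                    ∀ w → w ≢ u → w ≢ v → deg G w ≡ d w
  deg≡d-elsewhere total w w≢u w≢v = ∣m-n∣≡0⇒m≡n (n≤0⇒n≡0 (+-cancelˡ-≤ 2 _ 0 (begin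
    2 + err w             ≡⟨ cong (_+ err w) (cong₂ _+_ err-u err-v) ⟨
    err u + err v + err w ≤⟨ sum-distinct₃-≤ err excess≢deficit (w≢u ∘ sym) (w≢v ∘ sym) ⟩
    sum err               ≡⟨ sumFin≡sum err ⟨
    sumFin err            ≡⟨ total ⟩
    2                     ∎)))
    where
    open ≤-Reasoning
    err : Fin n → ℕ
    err i = ∣ deg G i - d i ∣
    err-u : err u ≡ 1
    err-u rewrite deg-u = trans (∣-∣-comm (d u + 1) (d u)) (∣m-m+n∣≡n (d u) 1)
    err-v : err v ≡ 1
    err-v rewrite sym deg-v = ∣m-m+n∣≡n (deg G v) 1

module NoShortAlternatingPath {n} (G : Graph n) (d : DegSeq n) (u v : Fin n)
  (deg-u : deg G u ≡ d u + 1) (deg-v : deg G v + 1 ≡ d v)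
  (deg-others : ∀ w → w ≢ u → w ≢ v → deg G w ≡ d w)
  (no-alt₂ : ∀ x → ¬ Alt₂ G u v x)
  (no-alt₄ : ∀ x y z → ¬ Alt₄ G u v x y z)
  where

  A : Fin n → Fin n → ℕ
  A i j = χ (adj G i j)

  deg+1≡sum : ∀ i → deg G i + 1 ≡ ∑[ j < n ] (A i j + pointMass i 1 j)
  deg+1≡sum i = begin
    deg G i + 1                          ≡⟨ cong₂ _+_ (sumFin≡sum (A i)) (sym (sum-pointMass i 1)) ⟩
    sum (A i) + sum (pointMass i 1)      ≡⟨ ∑-distrib-+ (A i) (pointMass i 1) ⟨
    ∑[ j < n ] (A i j + pointMass i 1 j) ∎
    where open ≡-Reasoning

  d≤deg : ∀ z → z ≢ v → d z ≤ deg G z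
  d≤deg z z≢v with z ≟ u
  ... | yes refl = ≤-trans (m≤m+n (d u) 1) (≤-reflexive (sym deg-u))
  ... | no z≢u   = ≤-reflexive (sym (deg-others z z≢u z≢v))

  deg≤d+1 : ∀ z → deg G z ≤ d z + 1
  deg≤d+1 z with z ≟ u | z ≟ v
  ... | yes refl | _        = ≤-reflexive deg-u
  ... | no _     | yes refl = ≤-trans (m≤m+n (deg G v) 1) (≤-trans (≤-reflexive deg-v) (m≤m+n (d v) 1))
  ... | no z≢u   | no z≢v   = ≤-trans (≤-reflexive (deg-others z z≢u z≢v)) (m≤m+n (d z) 1)

  InW : Fin n → Set
  InW z = (z ≢ v) × (adj G v z ≡ false)

  inW? : ∀ z → Dec (InW z)
  inW? z = ¬? (z ≟ v) ×-dec (adj G v z Bool.≟ false)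

  |W| : ℕ
  |W| = ∑[ z < n ] 𝟙 (inW? z)

  degᵂ : Fin n → ℕ
  degᵂ y = ∑[ z < n ] (A y z * 𝟙 (inW? z))

  Covers : Fin n → Set
  Covers y = ∀ x → adj G u x ≡ true → (y ≡ x) ⊎ (adj G x y ≡ true)

  covers? : ∀ y → Dec (Covers y)
  covers? y = all? (λ x → (adj G u x Bool.≟ true) →-dec ((y ≟ x) ⊎-dec (adj G x y Bool.≟ true)))

  |C| : ℕ
  |C| = ∑[ y < n ] 𝟙 (covers? y)

  |W|+d≡n : |W| + d v ≡ n
  |W|+d≡n = begin
    |W| + d v                                            ≡⟨ cong (|W| +_) deg-v ⟨
    |W| + (deg G v + 1)                                  ≡⟨ cong (|W| +_) (deg+1≡sum v) ⟩
    |W| + ∑[ z < n ] (A v z + pointMass v 1 z)          ≡⟨ ∑-distrib-+ (𝟙 ∘ inW?) _ ⟨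
    ∑[ z < n ] (𝟙 (inW? z) + (A v z + pointMass v 1 z)) ≡⟨ sum-cong-≗ partition ⟩
    ∑[ z < n ] 1                                         ≡⟨ sum-const-1 n ⟩
    n                                                    ∎
    where
    open ≡-Reasoning
    partition : ∀ z → 𝟙 (inW? z) + (A v z + pointMass v 1 z) ≡ 1
    partition z with z ≟ v | adj G v z in vz
    ... | yes refl | true  = ⊥-elim (true≢false (trans (sym vz) (loopless G v)))
    ... | yes refl | false = refl
    ... | no _     | true  = refl
    ... | no _     | false = refl

  W-neighbour-covers : ∀ {z y} → InW z → adj G z y ≡ true → Covers y
  W-neighbour-covers {z} {y} (z≢v , vz) zy x ux with y ≟ x | adj G x y in xy
  ... | yes y≡x | _     = inj₁ y≡x
  ... | no _    | true  = inj₂ refl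
  ... | no y≢x  | false =
    ⊥-elim (no-alt₄ x y z (ux , y≢x , xy , trans (adj-sym G y z) zy , z≢v , trans (adj-sym G z v) vz))

  covering-degᵂ-bound : ∀ {y} → Covers y → degᵂ y + d u ≤ d y + 1
  covering-degᵂ-bound {y} cov = +-cancelʳ-≤ 1 _ _ (begin
    degᵂ y + d u + 1                         ≡⟨ +-assoc (degᵂ y) (d u) 1 ⟩
    degᵂ y + (d u + 1)                       ≡⟨ cong (degᵂ y +_) deg-u ⟨
    degᵂ y + deg G u                         ≡⟨ cong (degᵂ y +_) (sumFin≡sum (A u)) ⟩
    degᵂ y + sum (A u)                       ≡⟨ ∑-distrib-+ _ (A u) ⟨
    ∑[ z < n ] (A y z * 𝟙 (inW? z) + A u z)  ≤⟨ sum-mono-≤ (λ z → at z (inW? z)) ⟩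
    ∑[ z < n ] (A y z + pointMass y 1 z)     ≡⟨ deg+1≡sum y ⟨
    deg G y + 1                              ≤⟨ +-monoˡ-≤ 1 (deg≤d+1 y) ⟩
    d y + 1 + 1                              ∎)
    where
    open ≤-Reasoning
    at : ∀ z (w? : Dec (InW z)) → A y z * 𝟙 w? + A u z ≤ A y z + pointMass y 1 z
    at z w? with adj G u z in uz | w? | adj G y z in yz
    ... | true  | yes (z≢v , vz) | _     = ⊥-elim (no-alt₂ z (uz , z≢v , trans (adj-sym G z v) vz))
    ... | true  | no _           | true  = s≤s z≤n
    ... | false | yes _          | true  = s≤s z≤n
    ... | false | no _           | true  = z≤n
    ... | false | _              | false = z≤n
    ... | true  | no _           | false with cov z uz
    ...   | inj₁ refl = ≤-reflexive (sym (pointMass-diag y 1))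
    ...   | inj₂ zy   = ⊥-elim (true≢false (trans (sym zy) (trans (adj-sym G z y) yz)))

  |C|≤deg+1 : ∀ {x} → adj G u x ≡ true → |C| ≤ deg G x + 1
  |C|≤deg+1 {x} ux = ≤-trans (sum-mono-≤ (λ y → at y (covers? y))) (≤-reflexive (sym (deg+1≡sum x)))
    where
    at : ∀ y (c? : Dec (Covers y)) → 𝟙 c? ≤ A x y + pointMass x 1 y
    at y (no _)    = z≤n
    at y (yes cov) with cov x ux
    ... | inj₁ refl = ≤-trans (≤-reflexive (sym (pointMass-diag y 1))) (m≤n+m _ _)
    ... | inj₂ xy rewrite xy = s≤s z≤n

  u-has-neighbour : ∃ λ x → adj G u x ≡ true
  u-has-neighbour with any? (λ x → adj G u x Bool.≟ true)
  ... | yes found = found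
  ... | no none   = ⊥-elim (m+1+n≢0 (d u) (begin
    d u + 1      ≡⟨ deg-u ⟨
    deg G u      ≡⟨ sumFin≡sum (A u) ⟩
    sum (A u)    ≡⟨ sum-cong-≗ no-edge ⟩
    ∑[ z < n ] 0 ≡⟨ sum-replicate-zero n ⟩
    0            ∎))
    where
    open ≡-Reasoning
    no-edge : ∀ z → A u z ≡ 0
    no-edge z with adj G u z in uz
    ... | true  = ⊥-elim (none (z , uz))
    ... | false = refl

  e[W,-] : ℕ
  e[W,-] = ∑[ z < n ] ∑[ y < n ] (𝟙 (inW? z) * A z y)

  |W|-lower-degree : ∀ m → (∀ z → z ≢ v → m ≤ d z) → m * |W| ≤ e[W,-]
  |W|-lower-degree m m≤d = begin
    m * |W|                           ≡⟨ *-distribˡ-sum m (𝟙 ∘ inW?) ⟩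
    ∑[ z < n ] (m * 𝟙 (inW? z))       ≤⟨ sum-mono-≤ (λ z → at z (inW? z)) ⟩
    ∑[ z < n ] (𝟙 (inW? z) * deg G z) ≡⟨ sum-cong-≗ (λ z → expand z (𝟙 (inW? z))) ⟩
    e[W,-]                            ∎
    where
    open ≤-Reasoning
    expand : ∀ z k → k * deg G z ≡ ∑[ y < n ] (k * A z y)
    expand z k = trans (cong (k *_) (sumFin≡sum (A z))) (*-distribˡ-sum k (A z))
    at : ∀ z (w? : Dec (InW z)) → m * 𝟙 w? ≤ 𝟙 w? * deg G z
    at z (no _)          = ≤-reflexive (*-zeroʳ m)
    at z (yes (z≢v , _)) = begin
      m * 1       ≡⟨ *-identityʳ m ⟩
      m           ≤⟨ ≤-trans (m≤d z z≢v) (d≤deg z z≢v) ⟩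
      deg G z     ≡⟨ *-identityˡ (deg G z) ⟨
      1 * deg G z ∎

  e[W,-]≤e[C,W] : e[W,-] ≤ ∑[ y < n ] (𝟙 (covers? y) * degᵂ y)
  e[W,-]≤e[C,W] = begin
    e[W,-]                              ≤⟨ sum-mono-≤ (λ z → sum-mono-≤ (λ y → at z y (inW? z) (covers? y))) ⟩
    ∑[ z < n ] ∑[ y < n ] e z y         ≡⟨ ∑-comm e ⟩
    ∑[ y < n ] ∑[ z < n ] e z y         ≡⟨ sum-cong-≗ (λ y → *-distribˡ-sum (𝟙 (covers? y)) (W-row y)) ⟨
    ∑[ y < n ] (𝟙 (covers? y) * degᵂ y) ∎
    where
    open ≤-Reasoning
    W-row : Fin n → Fin n → ℕ
    W-row y z = A y z * 𝟙 (inW? z)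
    e : Fin n → Fin n → ℕ
    e z y = 𝟙 (covers? y) * W-row y z
    at : ∀ z y (w? : Dec (InW z)) (c? : Dec (Covers y)) → 𝟙 w? * A z y ≤ 𝟙 c? * (A y z * 𝟙 w?)
    at z y (no _)    _ = z≤n
    at z y (yes inW) c? with adj G z y in zy | c?
    ... | false | _                                  = z≤n
    ... | true  | yes _ rewrite adj-sym G y z | zy = ≤-refl
    ... | true  | no ¬cov                            = ⊥-elim (¬cov (W-neighbour-covers inW zy))

  counting-bound : DegreeCountingBound d u v
  counting-bound m M S m≤d d≤M spread = begin
    m * n               ≡⟨ cong (m *_) |W|+d≡n ⟨
    m * (|W| + d v)     ≡⟨ *-distribˡ-+ m |W| (d v) ⟩
    m * |W| + m * d v   ≤⟨ +-mono-≤ m|W|≤S[M+2] (*-monoʳ-≤ m (d≤M v)) ⟩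
    S * (M + 2) + m * M ∎
    where
    open ≤-Reasoning
    x : Fin n
    x = proj₁ u-has-neighbour
    degᵂ≤S : ∀ y (c? : Dec (Covers y)) → 𝟙 c? * degᵂ y ≤ S * 𝟙 c?
    degᵂ≤S y (no _)    = z≤n
    degᵂ≤S y (yes cov) = begin
      1 * degᵂ y ≡⟨ *-identityˡ (degᵂ y) ⟩
      degᵂ y     ≤⟨ +-cancelʳ-≤ (d u) _ _ (≤-trans (covering-degᵂ-bound cov)
                                           (≤-trans (spread y) (≤-reflexive (+-comm (d u) S)))) ⟩
      S          ≡⟨ *-identityʳ S ⟨
      S * 1      ∎
    m|W|≤S[M+2] : m * |W| ≤ S * (M + 2)
    m|W|≤S[M+2] = begin
      m * |W|                              ≤⟨ |W|-lower-degree m m≤d ⟩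
      e[W,-]                               ≤⟨ e[W,-]≤e[C,W] ⟩
      ∑[ y < n ] (𝟙 (covers? y) * degᵂ y)  ≤⟨ sum-mono-≤ (λ y → degᵂ≤S y (covers? y)) ⟩
      ∑[ y < n ] (S * 𝟙 (covers? y))       ≡⟨ *-distribˡ-sum S (𝟙 ∘ covers?) ⟨
      S * |C|                              ≤⟨ *-monoʳ-≤ S (|C|≤deg+1 (proj₂ u-has-neighbour)) ⟩
      S * (deg G x + 1)                    ≤⟨ *-monoʳ-≤ S (+-monoˡ-≤ 1 (deg≤d+1 x)) ⟩
      S * (d x + 1 + 1)                    ≡⟨ cong (S *_) (+-assoc (d x) 1 1) ⟩
      S * (d x + 2)                        ≤⟨ *-monoʳ-≤ S (+-monoˡ-≤ 2 (d≤M x)) ⟩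
      S * (M + 2)                          ∎

-- Multiplying the counting bound by q and the density bound by Y leaves Y² ≤ 8qtY, against Y ≥ 127qt.
quadratic-contradiction : ∀ q t Y n → 1 ≤ q → 1 ≤ t → 128 * (q * t) ≤ Y + t →
                          suc q * (Y + t) ≤ q * n →
                          Y * n ≤ (t + t + 1) * (Y + t + t + 2) + Y * (Y + t + t) → ⊥
quadratic-contradiction q t Y n 1≤q 1≤t 128K≤Y+t density counting =
  <⇒≱ (*-monoˡ-< K {8} {127} (from-yes (8 <? 127))) (≤-trans 127K≤Y Y≤8K)
  where
  open ≤-Reasoning
  K : ℕ
  K = q * t
  t≤K : t ≤ K
  t≤K = ≤-trans (≤-reflexive (sym (*-identityˡ t))) (*-monoˡ-≤ t 1≤q)
  1≤K : 1 ≤ K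
  1≤K = ≤-trans 1≤t t≤K
  instance
    K≢0 : NonZero K
    K≢0 = >-nonZero 1≤K
  127K≤Y : 127 * K ≤ Y
  127K≤Y = +-cancelʳ-≤ K _ _ (begin
    127 * K + K ≡⟨ +-comm (127 * K) K ⟩
    128 * K     ≤⟨ 128K≤Y+t ⟩
    Y + t       ≤⟨ +-monoʳ-≤ Y t≤K ⟩
    Y + K       ∎)
  instance
    Y≢0 : NonZero Y
    Y≢0 = >-nonZero (≤-trans (≤-trans 1≤K (m≤n*m K 127)) 127K≤Y)
  lower-order : q * (t + t + 1) * (Y + t + t + 2) ≤ 6 * K * Y
  lower-order = begin
    q * (t + t + 1) * (Y + t + t + 2) ≤⟨ *-mono-≤ (*-monoʳ-≤ q (+-monoʳ-≤ (t + t) 1≤t)) Y+t+t+2≤Y+Y ⟩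
    q * (t + t + t) * (Y + Y)         ≡⟨ identity q t Y ⟩
    6 * K * Y                         ∎
    where
    identity : ∀ q t Y → q * (t + t + t) * (Y + Y) ≡ 6 * (q * t) * Y
    identity = solve-∀
    Y+t+t+2≤Y+Y : Y + t + t + 2 ≤ Y + Y
    Y+t+t+2≤Y+Y = begin
      Y + t + t + 2       ≡⟨ reassoc Y t ⟩
      Y + (t + t + 1 + 1) ≤⟨ +-monoʳ-≤ Y (+-mono-≤ (+-mono-≤ (+-mono-≤ t≤K t≤K) 1≤K) 1≤K) ⟩
      Y + (K + K + K + K) ≡⟨ cong (Y +_) (four K) ⟩
      Y + 4 * K           ≤⟨ +-monoʳ-≤ Y (≤-trans (*-monoˡ-≤ K {4} {127} (from-yes (4 ≤? 127))) 127K≤Y) ⟩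
      Y + Y               ∎
      where
      reassoc : ∀ Y t → Y + t + t + 2 ≡ Y + (t + t + 1 + 1)
      reassoc = solve-∀
      four : ∀ K → K + K + K + K ≡ 4 * K
      four = solve-∀
  Y≤8K : Y ≤ 8 * K
  Y≤8K = *-cancelʳ-≤ Y (8 * K) Y (+-cancelˡ-≤ (q * (Y * Y)) _ _ (begin
    q * (Y * Y) + Y * Y                                    ≤⟨ m≤m+n _ (suc q * (t * Y)) ⟩
    q * (Y * Y) + Y * Y + suc q * (t * Y)                  ≡⟨ expand-left q t Y ⟩
    Y * (suc q * (Y + t))                                  ≤⟨ *-monoʳ-≤ Y density ⟩
    Y * (q * n)                                            ≡⟨ swap Y q n ⟩
    q * (Y * n)                                            ≤⟨ *-monoʳ-≤ q counting ⟩
    q * ((t + t + 1) * (Y + t + t + 2) + Y * (Y + t + t))  ≡⟨ expand-right q t Y ⟩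
    q * (Y * Y) + (q * (t + t + 1) * (Y + t + t + 2) + 2 * K * Y)
                                                           ≤⟨ +-monoʳ-≤ (q * (Y * Y)) (+-monoˡ-≤ (2 * K * Y) lower-order) ⟩
    q * (Y * Y) + (6 * K * Y + 2 * K * Y)                  ≡⟨ cong (q * (Y * Y) +_) (collect K Y) ⟩
    q * (Y * Y) + 8 * K * Y                                ∎))
    where
    expand-left : ∀ q t Y → q * (Y * Y) + Y * Y + suc q * (t * Y) ≡ Y * (suc q * (Y + t))
    expand-left = solve-∀
    swap : ∀ Y q n → Y * (q * n) ≡ q * (Y * n)
    swap = solve-∀
    expand-right : ∀ q t Y → q * ((t + t + 1) * (Y + t + t + 2) + Y * (Y + t + t)) ≡
                             q * (Y * Y) + (q * (t + t + 1) * (Y + t + t + 2) + 2 * (q * t) * Y)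
    expand-right = solve-∀
    collect : ∀ K Y → 6 * K * Y + 2 * K * Y ≡ 8 * K * Y
    collect = solve-∀

^-distribʳ-* : ∀ m n k → (m * n) ^ k ≡ m ^ k * n ^ k
^-distribʳ-* m n zero    = refl
^-distribʳ-* m n (suc k) = trans (cong (m * n *_) (^-distribʳ-* m n k)) (interchange m n (m ^ k) (n ^ k))
  where
  interchange : ∀ m n x y → m * n * (x * y) ≡ m * x * (n * y)
  interchange = solve-∀

^≤^⇒< : ∀ {D r a b} → D ^ b ≤ r ^ a → a < b → 1 < r → D < r
^≤^⇒< {D} {r} {a} {b} D^b≤r^a a<b 1<r =
  ≰⇒> (λ r≤D → <⇒≱ (^-monoʳ-< r 1<r a<b) (≤-trans (^-monoˡ-≤ b r≤D) D^b≤r^a))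

^≤^⇒*[1+]≤ : ∀ {D r a b L} → D ^ b ≤ r ^ a → a < b → 1 ≤ L → (2 * L) ^ b ≤ r → L * (D + 1) ≤ r
^≤^⇒*[1+]≤ {zero} {r} {a} {suc b} {L} _ _ 1≤L [2L]^b≤r = begin
  L * 1           ≡⟨ *-identityʳ L ⟩
  L               ≤⟨ m≤m+n L (L + 0) ⟩
  2 * L           ≤⟨ 2L≤[2L]^b ⟩
  (2 * L) ^ suc b ≤⟨ [2L]^b≤r ⟩
  r               ∎
  where
  open ≤-Reasoning
  instance
    2L≢0 : NonZero (2 * L)
    2L≢0 = >-nonZero (≤-trans 1≤L (m≤m+n L (L + 0)))
  2L≤[2L]^b : 2 * L ≤ (2 * L) ^ suc b
  2L≤[2L]^b = ≤-trans (≤-reflexive (sym (*-identityʳ (2 * L)))) (^-monoʳ-≤ (2 * L) (s≤s (z≤n {b})))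
^≤^⇒*[1+]≤ {suc D} {r} {a} {suc b} {L} D^b≤r^a (s≤s a≤b) 1≤L [2L]^b≤r =
  ≮⇒≥ (λ r<L[D+1] → <⇒≱ (r<[2L]^b r<L[D+1]) [2L]^b≤r)
  where
  open ≤-Reasoning
  instance
    2L≢0 : NonZero (2 * L)
    2L≢0 = >-nonZero (≤-trans 1≤L (m≤m+n L (L + 0)))
    r≢0 : NonZero r
    r≢0 = >-nonZero (≤-trans (m^n>0 (2 * L) (suc b)) [2L]^b≤r)
  r<[2L]^b : r < L * (suc D + 1) → r < (2 * L) ^ suc b
  r<[2L]^b r<L[D+1] = *-cancelʳ-< (r ^ b) r ((2 * L) ^ suc b) (begin-strict
    r * r ^ b                          <⟨ ^-monoˡ-< (suc b) r<2LD ⟩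
    (2 * L * suc D) ^ suc b            ≡⟨ ^-distribʳ-* (2 * L) (suc D) (suc b) ⟩
    (2 * L) ^ suc b * suc D ^ suc b    ≤⟨ *-monoʳ-≤ ((2 * L) ^ suc b) D^b≤r^a ⟩
    (2 * L) ^ suc b * r ^ a            ≤⟨ *-monoʳ-≤ ((2 * L) ^ suc b) (^-monoʳ-≤ r a≤b) ⟩
    (2 * L) ^ suc b * r ^ b            ∎)
    where
    r<2LD : r < 2 * L * suc D
    r<2LD = <-≤-trans r<L[D+1] (begin
      L * (suc D + 1)     ≤⟨ *-monoʳ-≤ L (+-monoʳ-≤ (suc D) (s≤s z≤n)) ⟩
      L * (suc D + suc D) ≡⟨ double L (suc D) ⟩
      2 * L * suc D       ∎)
      where
      double : ∀ L x → L * (x + x) ≡ 2 * L * x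
      double = solve-∀

*≤⇒≤/ : ∀ {k r} L .{{_ : NonZero L}} → k * L ≤ r → k ≤ r / L
*≤⇒≤/ {k} L kL≤r = ≤-trans (≤-reflexive (sym (m*n/n≡m k L))) (/-monoˡ-≤ L kL≤r)

module _ (a b q : ℕ) (a<b : a < b) (1≤q : 1 ≤ q) where

  -- For r ≥ R, |d i − r|^b ≤ r^a forces |d i − r| < r / L; 128 is what quadratic-contradiction needs.
  L : ℕ
  L = 128 * q

  R : ℕ
  R = (2 * L) ^ b

  n-bound : ℕ
  n-bound = (R + R + 1) * (R + R + 2) + (R + R)

  large-degree-impossible : ∀ {n r} {d : DegSeq n} {u v} → NearRegular a b r d → R ≤ r →
                            suc q * r ≤ q * n → DegreeCountingBound d u v → ⊥
  large-degree-impossible {n} {r} {d} {u} near R≤r fraction counting =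
    quadratic-contradiction q t Y n 1≤q 1≤t 128qt≤r (subst (λ x → suc q * x ≤ q * n) (sym Y+t≡r) fraction)
      (counting Y (Y + t + t) (t + t + 1) (λ z _ → Y≤d z) d≤Y+t+t spread)
    where
    1≤L : 1 ≤ L
    1≤L = ≤-trans 1≤q (m≤n*m q 128)
    instance
      L≢0 : NonZero L
      L≢0 = >-nonZero 1≤L
    t : ℕ
    t = r / L
    deviation+1≤t : ∀ i → ∣ d i - r ∣ + 1 ≤ t
    deviation+1≤t i = *≤⇒≤/ L (subst (_≤ r) (*-comm L _) (^≤^⇒*[1+]≤ (near i) a<b 1≤L R≤r))
    1≤t : 1 ≤ t
    1≤t = ≤-trans (m≤n+m 1 _) (deviation+1≤t u)
    Y : ℕ
    Y = r ∸ t
    Y+t≡r : Y + t ≡ r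
    Y+t≡r = m∸n+n≡m (m/n≤m r L)
    deviation≤t : ∀ i → ∣ d i - r ∣ ≤ t
    deviation≤t i = ≤-trans (m≤m+n _ 1) (deviation+1≤t i)
    128qt≤r : 128 * (q * t) ≤ Y + t
    128qt≤r = begin
      128 * (q * t) ≡⟨ rearrange q t ⟩
      t * L         ≤⟨ m/n*n≤m r L ⟩
      r             ≡⟨ Y+t≡r ⟨
      Y + t         ∎
      where
      open ≤-Reasoning
      rearrange : ∀ q t → 128 * (q * t) ≡ t * (128 * q)
      rearrange = solve-∀
    d≤Y+t+t : ∀ i → d i ≤ Y + t + t
    d≤Y+t+t i = begin
      d i                 ≤⟨ m≤n+∣m-n∣ (d i) r ⟩
      r + ∣ d i - r ∣     ≤⟨ +-monoʳ-≤ r (deviation≤t i) ⟩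
      r + t               ≡⟨ cong (_+ t) Y+t≡r ⟨
      Y + t + t           ∎
      where open ≤-Reasoning
    Y≤d : ∀ z → Y ≤ d z
    Y≤d z = +-cancelʳ-≤ t Y (d z) (begin
      Y + t               ≡⟨ Y+t≡r ⟩
      r                   ≤⟨ m≤n+∣n-m∣ r (d z) ⟩
      d z + ∣ d z - r ∣   ≤⟨ +-monoʳ-≤ (d z) (deviation≤t z) ⟩
      d z + t             ∎)
      where open ≤-Reasoning
    spread : ∀ y → d y + 1 ≤ d u + (t + t + 1)
    spread y = begin
      d y + 1             ≤⟨ +-monoˡ-≤ 1 (d≤Y+t+t y) ⟩
      Y + t + t + 1       ≤⟨ +-monoˡ-≤ 1 (+-monoˡ-≤ t (+-monoˡ-≤ t (Y≤d u))) ⟩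
      d u + t + t + 1     ≡⟨ reassoc (d u) t ⟩
      d u + (t + t + 1)   ∎
      where
      open ≤-Reasoning
      reassoc : ∀ x t → x + t + t + 1 ≡ x + (t + t + 1)
      reassoc = solve-∀

  small-degree-bound : ∀ {n r} {d : DegSeq n} {u v} → NearRegular a b r d → 2 ≤ r → r < R →
                       DegreeCountingBound d u v → n ≤ n-bound
  small-degree-bound {n} {r} {d} {u} near 2≤r r<R counting = begin
    n                                        ≡⟨ *-identityˡ n ⟨
    1 * n                                    ≤⟨ counting 1 (r + r) (r + r + 1) (λ z _ → 1≤d z) d≤r+r spread ⟩
    (r + r + 1) * (r + r + 2) + 1 * (r + r)  ≤⟨ +-mono-≤ (*-mono-≤ (+-monoˡ-≤ 1 r+r≤R+R) (+-monoˡ-≤ 2 r+r≤R+R))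
                                                          (≤-trans (≤-reflexive (*-identityˡ (r + r))) r+r≤R+R) ⟩
    n-bound                                  ∎
    where
    open ≤-Reasoning
    r+r≤R+R : r + r ≤ R + R
    r+r≤R+R = +-mono-≤ (<⇒≤ r<R) (<⇒≤ r<R)
    deviation<r : ∀ i → ∣ d i - r ∣ < r
    deviation<r i = ^≤^⇒< (near i) a<b 2≤r
    1≤d : ∀ z → 1 ≤ d z
    1≤d z = +-cancelʳ-< ∣ d z - r ∣ 0 (d z) (<-≤-trans (deviation<r z) (m≤n+∣n-m∣ r (d z)))
    d≤r+r : ∀ i → d i ≤ r + r
    d≤r+r i = ≤-trans (m≤n+∣m-n∣ (d i) r) (+-monoʳ-≤ r (<⇒≤ (deviation<r i)))
    spread : ∀ y → d y + 1 ≤ d u + (r + r + 1)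
    spread y = ≤-trans (+-monoˡ-≤ 1 (d≤r+r y)) (m≤n+m _ (d u))

  near-regular-strongly-stable : (r : ℕ → ℕ) (n₀ : ℕ) →
    (∀ n → n₀ ≤ n → (2 ≤ r n) × (suc q * r n ≤ q * n)) →
    ∃ λ n₁ → StronglyStable (NearRegClass a b r n₁)
  near-regular-strongly-stable r n₀ r-bounds = suc (n₀ + n-bound) , 4 , short-path
    where
    short-path : ∀ n (d : DegSeq n) → NearRegClass a b r (suc (n₀ + n-bound)) n d →
      ∀ (G : Graph n) → InG' d G →
      ∀ (u v : Fin n) → deg G u ≡ d u + 1 → deg G v + 1 ≡ d v →
      ∃ λ ℓ → ℓ ≤ 4 × AlternatingPath G u v ℓ
    short-path n d (n₁≤n , near) G (_ , discrepancy) u v deg-u deg-v =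
      short-alternating-path G u v λ no-alt₂ no-alt₄ →
        counting-impossible (NoShortAlternatingPath.counting-bound G d u v deg-u deg-v
                              (deg≡d-elsewhere G d deg-u deg-v discrepancy) no-alt₂ no-alt₄)
      where
      n₀≤n : n₀ ≤ n
      n₀≤n = ≤-trans (m≤m+n n₀ n-bound) (≤-trans (n≤1+n _) n₁≤n)
      counting-impossible : DegreeCountingBound d u v → ⊥
      counting-impossible counting with R ≤? r n | r-bounds n n₀≤n
      ... | yes R≤r | _ , fraction = large-degree-impossible near R≤r fraction counting
      ... | no R≰r  | 2≤r , _      =
        <⇒≱ n₁≤n (≤-trans (small-degree-bound near 2≤r (≰⇒> R≰r) counting) (m≤n+m n-bound n₀))

1≤e∸1 : ∀ {c e} → 0 < c → c < e → 1 ≤ e ∸ 1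
1≤e∸1 {suc c} {suc e} _ (s≤s c<e) = ≤-trans (s≤s z≤n) c<e

-- r ≤ (1 − c/e) n implies r ≤ (1 − 1/e) n, i.e. (q + 1) r ≤ q n for q = e − 1.
fraction-bound : ∀ {c e x y} → 0 < c → c < e → e * x ≤ (e ∸ c) * y → suc (e ∸ 1) * x ≤ (e ∸ 1) * y
fraction-bound {suc c} {suc e} {x} {y} _ _ ex≤ = ≤-trans ex≤ (*-monoˡ-≤ y (m∸n≤m e c))

proposition2p8 : (a b c e : ℕ) → 0 < a → 2 * a < b → 0 < c → c < e →
    (r : ℕ → ℕ) → (n₀ : ℕ) →
    (∀ n → n₀ ≤ n → (2 ≤ r n) × (e * r n ≤ (e ∸ c) * n)) →
    ∃ λ (n₁ : ℕ) → StronglyStable (NearRegClass a b r n₁)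
proposition2p8 a b c e _ 2a<b 0<c c<e r n₀ r-bounds =
  near-regular-strongly-stable a b (e ∸ 1) a<b (1≤e∸1 0<c c<e) r n₀
    (λ n n₀≤n → map₂ (fraction-bound 0<c c<e) (r-bounds n n₀≤n))
  where
  a<b : a < b
  a<b = ≤-<-trans (m≤m+n a (a + 0)) 2a<b
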